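{- Fix an atomic $\textsc{DT-FOIL}$ formula $\rho[v_1,\dots,v_\ell](x,y)$ that represents a strict partial order. Then there exists a fixed polynomial $p$ such that for every $n$ and every path $(\mathbf{e}_1,\dots,\mathbf{e}_k)$ of dimension $n$ in $\rho[v_1,\dots,v_\ell](x,y)$, it holds that $k\le p(n)$.
   Context: Partial instances of dimension $n$ are tuples in $\{0,1,\bot\}^n$; $\mathbf{e}_\bot=\{i\mid\mathbf{e}[i]=\bot\}$. Atomic $\textsc{DT-FOIL}$ formulas are first-order formulas over $\{\subseteq,\preceq\}$, evaluated on a decision tree $\mathcal{T}$ of dimension $n$ (a rooted binary tree with features $1,\dots,n$ at internal nodes, $0/1$ edges, $\mathsf{true}/\mathsf{false}$ leaves) over domain $\{0,1,\bot\}^n$, with $\mathbf{e}_1\subseteq\mathbf{e}_2$ iff $\mathbf{e}_1[i]=\mathbf{e}_2[i]$ whenever $\mathbf{e}_1[i]\neq\bot$, and $\mathbf{e}\preceq\mathbf{e}'$ iff $|\mathbf{e}_\bot|\ge|\mathbf{e}'_\bot|$. $\rho[v_1,\dots,v_\ell](x,y)$ denotes $\rho(x,y,v_1,\dots,v_\ell)$ with parameters $v_i$; it represents a strict partial order if for every decision tree and every assignment of the parameters, the relation in $x,y$ is irreflexive and transitive. A sequence $(\mathbf{e}_1,\dots,\mathbf{e}_k)$ is a path of dimension $n$ in $\rho[v_1,\dots,v_\ell](x,y)$ if each $\mathbf{e}_i$ is a partial instance of dimension $n$ and there exist a decision tree $\mathcal{T}$ of dimension $n$ and partial instances $\mathbf{e}'_1,\dots,\mathbf{e}'_\ell$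 of dimension $n$ with $\mathcal{T}\models\rho[\mathbf{e}'_1,\dots,\mathbf{e}'_\ell](\mathbf{e}_i,\mathbf{e}_{i+1})$ for every $i\in\{1,\dots,k-1\}$. -}

module Defs where

open import Data.Nat using (ℕ; zero; suc; _+_; _*_; _≥_; _≤_)
open import Data.Fin using (Fin; zero; suc)
open import Data.Vec using (Vec; []; _∷_; lookup)
open import Data.Bool using (Bool)
open import Data.List using (List; []; _∷_)
open import Data.Product using (_×_; Σ; ∃)
open import Data.Sum using (_⊎_)
open import Data.Empty using (⊥)
open import Data.Unit using (⊤)
open import Relation.Nullary using (¬_)
open import Relation.Binary.PropositionalEquality using (_≡_)

data Val : Set where
  v0 v1 vbot : Val

PI : ℕ → Set
PI n = Vec Val n

countBot : ∀ {n} → PI n → ℕ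
countBot [] = 0
countBot (vbot ∷ e) = suc (countBot e)
countBot (v0 ∷ e) = countBot e
countBot (v1 ∷ e) = countBot e

_⊑_ : ∀ {n} → PI n → PI n → Set
_⊑_ {n} e₁ e₂ = (i : Fin n) → ¬ (lookup e₁ i ≡ vbot) → lookup e₁ i ≡ lookup e₂ i

_⪯_ : ∀ {n} → PI n → PI n → Set
e ⪯ e' = countBot e ≥ countBot e'

-- decision trees of dimension n: features 1..n (here Fin n) at internal nodes,
-- a 0-child and a 1-child, Boolean (true/false) leaves
data DT (n : ℕ) : Set where
  leaf : Bool → DT n
  node : Fin n → DT n → DT n → DT n

-- first-order formulas over the vocabulary {⊆, ⪯}, with free variables in Fin m
-- (de Bruijn style: ∃/∀ bind the new variable zero)
data Form (m : ℕ) : Set where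
  sub  : Fin m → Fin m → Form m
  prec : Fin m → Fin m → Form m
  neg  : Form m → Form m
  and  : Form m → Form m → Form m
  or   : Form m → Form m → Form m
  ex   : Form (suc m) → Form m
  all  : Form (suc m) → Form m

extend : ∀ {n m} → PI n → (Fin m → PI n) → Fin (suc m) → PI n
extend e σ zero = e
extend e σ (suc i) = σ i

⟦_⟧ : ∀ {m} → Form m → ∀ {n} → DT n → (Fin m → PI n) → Set
⟦ sub x y ⟧ T σ = σ x ⊑ σ y
⟦ prec x y ⟧ T σ = σ x ⪯ σ y
⟦ neg φ ⟧ T σ = ¬ ⟦ φ ⟧ T σ
⟦ and φ ψ ⟧ T σ = ⟦ φ ⟧ T σ × ⟦ ψ ⟧ T σ
⟦ or φ ψ ⟧ T σ = ⟦ φ ⟧ T σ ⊎ ⟦ ψ ⟧ T σ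
⟦ ex φ ⟧ {n} T σ = Σ (PI n) λ e → ⟦ φ ⟧ T (extend e σ)
⟦ all φ ⟧ {n} T σ = (e : PI n) → ⟦ φ ⟧ T (extend e σ)

-- ρ[v₁..v_ℓ](x,y) is a formula with free variables 0 = x, 1 = y, 2+i = v_{i+1}
assign : ∀ {n ℓ} → PI n → PI n → Vec (PI n) ℓ → Fin (2 + ℓ) → PI n
assign x y vs zero = x
assign x y vs (suc zero) = y
assign x y vs (suc (suc i)) = lookup vs i

Holds : ∀ {ℓ n} → Form (2 + ℓ) → DT n → Vec (PI n) ℓ → PI n → PI n → Set
Holds ρ T vs x y = ⟦ ρ ⟧ T (assign x y vs)

StrictPartialOrder : ∀ {ℓ} → Form (2 + ℓ) → Set
StrictPartialOrder {ℓ} ρ =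
  ∀ (n : ℕ) (T : DT n) (vs : Vec (PI n) ℓ) →
    (∀ x → ¬ Holds ρ T vs x x) ×
    (∀ x y z → Holds ρ T vs x y → Holds ρ T vs y z → Holds ρ T vs x z)

Chain : ∀ {n ℓ} → Form (2 + ℓ) → DT n → Vec (PI n) ℓ → List (PI n) → Set
Chain ρ T vs [] = ⊤
Chain ρ T vs (e ∷ []) = ⊤
Chain ρ T vs (e ∷ e' ∷ es) = Holds ρ T vs e e' × Chain ρ T vs (e' ∷ es)

IsPath : ∀ {ℓ} → Form (2 + ℓ) → (n : ℕ) → List (PI n) → Set
IsPath {ℓ} ρ n es = Σ (DT n) λ T → Σ (Vec (PI n) ℓ) λ vs → Chain ρ T vs es

-- polynomials with natural-number coefficients (constant term first), Horner evaluation
evalPoly : List ℕ → ℕ → ℕ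
evalPoly [] x = 0
evalPoly (c ∷ cs) x = c + x * evalPoly cs x

-- Colour each feature i by the column (v₁[i], …, v_ℓ[i]) of the parameters. Permuting
-- features within colour classes preserves ⊆ and ⪯ and fixes every parameter, so it is an
-- automorphism of the structure and preserves ρ. If x ρ y and x, y have the same number of
-- features of each (value, colour) pair, such a permutation π maps x to y; then
-- x ρ πx ρ π²x ρ … is an infinite ascending chain in a finite strict order, which is
-- impossible. Hence the elements of a path have pairwise different count profiles, and
-- there are at most (n + 1)^(3^(ℓ+1)) of those.
module Submission where

open import Defs
open import Data.Nat.Properties
  using (+-0-commutativeMonoid; +-cancelˡ-≡; +-identityʳ; *-zeroʳ; m≤n⇒m≤1+n; 1+n≰n)
open import Algebra.Properties.CommutativeMonoid.Sum +-0-commutativeMonoid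
  using (sum; sum-permute; sum-cong-≗)
open import Data.Bool using (if_then_else_)
open import Data.Empty using (⊥-elim)
open import Data.Fin using (Fin; zero; suc; fromℕ<; funToFin; finToFun) renaming (_<_ to _<ᶠ_)
open import Data.Fin.Permutation
  using (Permutation; _⟨$⟩ʳ_; inverseˡ; inverseʳ; flip; transpose; lift₀; _∘ₚ_)
  renaming (id to idₚ)
open import Data.Fin.Properties using (_≟_; <-cmp; injective⇒≤; finToFun-funToFin; fromℕ<-injective)
open import Data.List using (List; []; _∷_; length; iterate) renaming (lookup to lookupₗ)
open import Data.List.Properties using (length-iterate)
open import Data.List.Membership.Propositional.Properties using (∈-lookup)
open import Data.List.Relation.Unary.All as All using ()
open import Data.List.Relation.Unary.AllPairs using (AllPairs; _∷_)
open import Data.List.Relation.Unary.Linked using (Linked; []; [-]; _∷_)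
open import Data.List.Relation.Unary.Linked.Properties using (Linked⇒AllPairs)
open import Data.Nat using (ℕ; zero; suc; _+_; _*_; _^_; _≤_; s≤s; z≤n)
open import Data.Nat.Tactic.RingSolver using (solve-∀)
open import Data.Product using (Σ; ∃; _×_; _,_; proj₁; proj₂)
open import Data.Product.Function.NonDependent.Propositional using (_×-⇔_)
open import Data.Sum.Function.Propositional using (_⊎-⇔_)
open import Data.Vec using (Vec; []; _∷_; lookup; tabulate)
open import Data.Vec.Functional using (Vector)
open import Data.Vec.Properties using (lookup∘tabulate; tabulate∘lookup; tabulate-cong)
open import Function using (_∘_)
open import Function.Bundles using (_⇔_; mk⇔; Equivalence)
open import Function.Definitions using (Injective)
open import Relation.Binary.Definitions using (DecidableEquality; Transitive; tri<; tri≈; tri>)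
open import Relation.Binary.PropositionalEquality
open import Relation.Nullary using (¬_; does; yes; no)
open import Relation.Nullary.Decidable using (map′)

open Equivalence using (to; from)

funToFin-injective : ∀ {m k} {f g : Fin m → Fin k} → funToFin f ≡ funToFin g → f ≗ g
funToFin-injective {f = f} {g} eq i = begin
  f i                    ≡⟨ finToFun-funToFin f i ⟨
  finToFun (funToFin f) i ≡⟨ cong (λ c → finToFun c i) eq ⟩
  finToFun (funToFin g) i ≡⟨ finToFun-funToFin g i ⟩
  g i                    ∎
  where open ≡-Reasoning

lookup-≗⇒≡ : ∀ {A : Set} {n} {a b : Vec A n} → lookup a ≗ lookup b → a ≡ b
lookup-≗⇒≡ {a = a} {b} eq = trans (sym (tabulate∘lookup a)) (trans (tabulate-cong eq) (tabulate∘lookup b))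

toFin3 : Val → Fin 3
toFin3 v0 = zero
toFin3 v1 = suc zero
toFin3 vbot = suc (suc zero)

fromFin3 : Fin 3 → Val
fromFin3 zero = v0
fromFin3 (suc zero) = v1
fromFin3 (suc (suc zero)) = vbot

fromFin3∘toFin3 : ∀ v → fromFin3 (toFin3 v) ≡ v
fromFin3∘toFin3 v0 = refl
fromFin3∘toFin3 v1 = refl
fromFin3∘toFin3 vbot = refl

toFin3-injective : ∀ {v w} → toFin3 v ≡ toFin3 w → v ≡ w
toFin3-injective {v} {w} eq =
  trans (sym (fromFin3∘toFin3 v)) (trans (cong fromFin3 eq) (fromFin3∘toFin3 w))

_≟ᵥ_ : DecidableEquality Val
v ≟ᵥ w = map′ toFin3-injective (cong toFin3) (toFin3 v ≟ toFin3 w)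

encode : ∀ {m} → (Fin m → Val) → Fin (3 ^ m)
encode f = funToFin (toFin3 ∘ f)

encode-injective : ∀ {m} {f g : Fin m → Val} → encode f ≡ encode g → f ≗ g
encode-injective eq i = toFin3-injective (funToFin-injective eq i)

module Counting {B : Set} (_≟B_ : DecidableEquality B) where

  count : ∀ {n} → B → Vector B n → ℕ
  count b u = sum (λ i → if does (u i ≟B b) then 1 else 0)

  count-cong : ∀ {n} b {u v : Vector B n} → u ≗ v → count b u ≡ count b v
  count-cong b u≗v = sum-cong-≗ (λ i → cong (λ c → if does (c ≟B b) then 1 else 0) (u≗v i))

  count-permute : ∀ {n} b (π : Permutation n n) (u : Vector B n) → count b (u ∘ (π ⟨$⟩ʳ_)) ≡ count b u
  count-permute b π u = sym (sum-permute _ π)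

  count≤ : ∀ {n} b (u : Vector B n) → count b u ≤ n
  count≤ {zero} b u = z≤n
  count≤ {suc n} b u with u zero ≟B b
  ... | yes _ = s≤s (count≤ b (u ∘ suc))
  ... | no _ = m≤n⇒m≤1+n (count≤ b (u ∘ suc))

  1≤count-head : ∀ {n} (u : Vector B (suc n)) → 1 ≤ count (u zero) u
  1≤count-head u with u zero ≟B u zero
  ... | yes _ = s≤s z≤n
  ... | no u₀≢u₀ = ⊥-elim (u₀≢u₀ refl)

  1≤count⇒∃ : ∀ {n b} (u : Vector B n) → 1 ≤ count b u → ∃ λ i → u i ≡ b
  1≤count⇒∃ {suc n} {b} u pos with u zero ≟B b
  ... | yes u₀≡b = zero , u₀≡b
  ... | no _ with i , uᵢ≡b ← 1≤count⇒∃ (u ∘ suc) pos = suc i , uᵢ≡b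

  count-tail : ∀ {n b} {u v : Vector B (suc n)} → u zero ≡ v zero → count b u ≡ count b v →
    count b (u ∘ suc) ≡ count b (v ∘ suc)
  count-tail {b = b} {u} {v} u₀≡v₀ eq = +-cancelˡ-≡ (if does (v zero ≟B b) then 1 else 0) _ _
    (subst (λ c → (if does (c ≟B b) then 1 else 0) + count b (u ∘ suc) ≡ count b v) u₀≡v₀ eq)

  -- Move an occurrence of v 0 to the front of u by a transposition, then recurse on the tails.
  equal-counts⇒permutation : ∀ {n} (u v : Vector B n) → (∀ b → count b u ≡ count b v) →
    Σ (Permutation n n) λ π → u ∘ (π ⟨$⟩ʳ_) ≗ v
  equal-counts⇒permutation {zero} u v _ = idₚ , λ ()
  equal-counts⇒permutation {suc n} u v same
    with j , uⱼ≡v₀ ← 1≤count⇒∃ u (subst (1 ≤_) (sym (same (v zero))) (1≤count-head v))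
    with π , u′∘π≗v ← equal-counts⇒permutation (u ∘ (transpose zero j ⟨$⟩ʳ_) ∘ suc) (v ∘ suc)
        (λ b → count-tail {u = u ∘ (transpose zero j ⟨$⟩ʳ_)} {v} uⱼ≡v₀
                 (trans (count-permute b (transpose zero j) u) (same b)))
    = lift₀ π ∘ₚ transpose zero j , λ { zero → uⱼ≡v₀ ; (suc i) → u′∘π≗v i }

open Counting

permute : ∀ {n} → Permutation n n → PI n → PI n
permute π e = tabulate (lookup e ∘ (π ⟨$⟩ʳ_))

lookup-permute : ∀ {n} (π : Permutation n n) e i → lookup (permute π e) i ≡ lookup e (π ⟨$⟩ʳ i)
lookup-permute π e = lookup∘tabulate _

permute-≗ : ∀ {n} (π : Permutation n n) a b → lookup a ∘ (π ⟨$⟩ʳ_) ≗ lookup b → permute π a ≡ b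
permute-≗ π a b eq = trans (tabulate-cong eq) (tabulate∘lookup b)

module _ {n} (π : Permutation n n) where

  permute-inverseˡ : ∀ e → permute (flip π) (permute π e) ≡ e
  permute-inverseˡ e = permute-≗ (flip π) (permute π e) e λ i →
    trans (lookup-permute π e _) (cong (lookup e) (inverseʳ π))

  permute-inverseʳ : ∀ e → permute π (permute (flip π) e) ≡ e
  permute-inverseʳ e = permute-≗ π (permute (flip π) e) e λ i →
    trans (lookup-permute (flip π) e _) (cong (lookup e) (inverseˡ π))

  permute-⊑ : ∀ a b → a ⊑ b → permute π a ⊑ permute π b
  permute-⊑ a b a⊑b i πaᵢ≢⊥ = begin
    lookup (permute π a) i ≡⟨ lookup-permute π a i ⟩
    lookup a (π ⟨$⟩ʳ i)    ≡⟨ a⊑b _ (πaᵢ≢⊥ ∘ trans (lookup-permute π a i)) ⟩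
    lookup b (π ⟨$⟩ʳ i)    ≡⟨ lookup-permute π b i ⟨
    lookup (permute π b) i ∎
    where open ≡-Reasoning

  countBot-permute : ∀ e → countBot (permute π e) ≡ countBot e
  countBot-permute e = begin
    countBot (permute π e)                  ≡⟨ countBot≡count (permute π e) ⟩
    count _≟ᵥ_ vbot (lookup (permute π e))  ≡⟨ count-cong _≟ᵥ_ vbot (lookup-permute π e) ⟩
    count _≟ᵥ_ vbot (lookup e ∘ (π ⟨$⟩ʳ_))  ≡⟨ count-permute _≟ᵥ_ vbot π (lookup e) ⟩
    count _≟ᵥ_ vbot (lookup e)              ≡⟨ countBot≡count e ⟨
    countBot e                              ∎
    where
    open ≡-Reasoning
    countBot≡count : ∀ {m} (e : PI m) → countBot e ≡ count _≟ᵥ_ vbot (lookup e)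
    countBot≡count [] = refl
    countBot≡count (v0 ∷ e) = countBot≡count e
    countBot≡count (v1 ∷ e) = countBot≡count e
    countBot≡count (vbot ∷ e) = cong suc (countBot≡count e)

permute-⊑⇔ : ∀ {n} (π : Permutation n n) a b → a ⊑ b ⇔ permute π a ⊑ permute π b
permute-⊑⇔ π a b = mk⇔ (permute-⊑ π a b) λ πa⊑πb →
  subst₂ _⊑_ (permute-inverseˡ π a) (permute-inverseˡ π b)
    (permute-⊑ (flip π) (permute π a) (permute π b) πa⊑πb)

permute-⪯⇔ : ∀ {n} (π : Permutation n n) a b → a ⪯ b ⇔ permute π a ⪯ permute π b
permute-⪯⇔ π a b = mk⇔
  (subst₂ _≤_ (sym (countBot-permute π b)) (sym (countBot-permute π a)))
  (subst₂ _≤_ (countBot-permute π b) (countBot-permute π a))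

¬-⇔ : ∀ {A B : Set} → A ⇔ B → (¬ A) ⇔ (¬ B)
¬-⇔ A⇔B = mk⇔ (λ ¬a b → ¬a (from A⇔B b)) (λ ¬b a → ¬b (to A⇔B a))

extend-permute : ∀ {n m} (π : Permutation n n) {e e′ : PI n} {σ σ′ : Fin m → PI n} →
  e′ ≡ permute π e → σ′ ≗ permute π ∘ σ → extend e′ σ′ ≗ permute π ∘ extend e σ
extend-permute _ e′≡πe _ zero = e′≡πe
extend-permute _ _ σ′≗πσ (suc i) = σ′≗πσ i

⟦⟧-permute : ∀ {m n} (π : Permutation n n) (φ : Form m) (T : DT n) {σ σ′ : Fin m → PI n} →
  σ′ ≗ permute π ∘ σ → ⟦ φ ⟧ T σ ⇔ ⟦ φ ⟧ T σ′
⟦⟧-permute π (sub x y) T {σ} σ′≗πσ =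
  subst₂ (λ a b → σ x ⊑ σ y ⇔ a ⊑ b) (sym (σ′≗πσ x)) (sym (σ′≗πσ y)) (permute-⊑⇔ π (σ x) (σ y))
⟦⟧-permute π (prec x y) T {σ} σ′≗πσ =
  subst₂ (λ a b → σ x ⪯ σ y ⇔ a ⪯ b) (sym (σ′≗πσ x)) (sym (σ′≗πσ y)) (permute-⪯⇔ π (σ x) (σ y))
⟦⟧-permute π (neg φ) T σ′≗πσ = ¬-⇔ (⟦⟧-permute π φ T σ′≗πσ)
⟦⟧-permute π (and φ ψ) T σ′≗πσ = ⟦⟧-permute π φ T σ′≗πσ ×-⇔ ⟦⟧-permute π ψ T σ′≗πσ
⟦⟧-permute π (or φ ψ) T σ′≗πσ = ⟦⟧-permute π φ T σ′≗πσ ⊎-⇔ ⟦⟧-permute π ψ T σ′≗πσ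
⟦⟧-permute π (ex φ) T σ′≗πσ = mk⇔
  (λ (e , h) → permute π e , to (⟦⟧-permute π φ T (extend-permute π {e = e} refl σ′≗πσ)) h)
  (λ (e , h) → permute (flip π) e ,
     from (⟦⟧-permute π φ T (extend-permute π (sym (permute-inverseʳ π e)) σ′≗πσ)) h)
⟦⟧-permute π (all φ) T σ′≗πσ = mk⇔
  (λ h e → to (⟦⟧-permute π φ T (extend-permute π (sym (permute-inverseʳ π e)) σ′≗πσ))
               (h (permute (flip π) e)))
  (λ h e → from (⟦⟧-permute π φ T (extend-permute π {e = e} refl σ′≗πσ)) (h (permute π e)))

Holds-permute : ∀ {ℓ n} (ρ : Form (2 + ℓ)) (T : DT n) {vs : Vec (PI n) ℓ} (π : Permutation n n) →
  (∀ r → permute π (lookup vs r) ≡ lookup vs r) →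
  ∀ {x y} → Holds ρ T vs x y → Holds ρ T vs (permute π x) (permute π y)
Holds-permute ρ T {vs} π fixes {x} {y} = to (⟦⟧-permute π ρ T assign-permute)
  where
  assign-permute : assign (permute π x) (permute π y) vs ≗ permute π ∘ assign x y vs
  assign-permute zero = refl
  assign-permute (suc zero) = refl
  assign-permute (suc (suc r)) = sym (fixes r)

module _ {A : Set} {R : A → A → Set} where

  AllPairs-lookup : ∀ {xs} → AllPairs R xs → ∀ {i j} → i <ᶠ j → R (lookupₗ xs i) (lookupₗ xs j)
  AllPairs-lookup (Rx ∷ _) {zero} {suc j} _ = All.lookup Rx (∈-lookup j)
  AllPairs-lookup (_ ∷ Rxs) {suc i} {suc j} (s≤s i<j) = AllPairs-lookup Rxs i<j

  AllPairs⇒length≤ : ∀ {N xs} (code : A → Fin N) → (∀ {a b} → R a b → code a ≢ code b) →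
    AllPairs R xs → length xs ≤ N
  AllPairs⇒length≤ {xs = xs} code separates Rxs = injective⇒≤ injective
    where
    injective : Injective _≡_ _≡_ (code ∘ lookupₗ xs)
    injective {i} {j} same with <-cmp i j
    ... | tri< i<j _ _ = ⊥-elim (separates (AllPairs-lookup Rxs i<j) same)
    ... | tri≈ _ i≡j _ = i≡j
    ... | tri> _ _ j<i = ⊥-elim (separates (AllPairs-lookup Rxs j<i) (sym same))

  Linked-iterate : ∀ {f : A → A} → (∀ {a b} → R a b → R (f a) (f b)) →
    ∀ {x} n → R x (f x) → Linked R (iterate f x n)
  Linked-iterate mono zero _ = []
  Linked-iterate mono (suc zero) _ = [-]
  Linked-iterate mono (suc (suc n)) Rx = Rx ∷ Linked-iterate mono (suc n) (mono Rx)

  preserving⇒¬ascent : ∀ {N} (code : A → Fin N) → Injective _≡_ _≡_ code →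
    (∀ a → ¬ R a a) → Transitive R →
    ∀ {f : A → A} → (∀ {a b} → R a b → R (f a) (f b)) → ∀ {x} → ¬ R x (f x)
  preserving⇒¬ascent {N} code code-injective irrefl transitive {f} mono {x} Rx = 1+n≰n
    (subst (_≤ N) (length-iterate f x (suc N))
      (AllPairs⇒length≤ code (λ {a} Rab same → irrefl a (subst (R a) (sym (code-injective same)) Rab))
        (Linked⇒AllPairs transitive (Linked-iterate mono (suc N) Rx))))

column : ∀ {m n} → Vec (PI n) m → Fin n → Fin m → Val
column es i r = lookup (lookup es r) i

-- The colour of feature i together with the value of the instance there.
profile : ∀ {ℓ n} → Vec (PI n) ℓ → PI n → Vector (Fin (3 ^ suc ℓ)) n
profile vs x i = encode (column (x ∷ vs) i)

equal-profile-counts⇒permute : ∀ {ℓ n} (vs : Vec (PI n) ℓ) {x y} →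
  (∀ k → count _≟_ k (profile vs x) ≡ count _≟_ k (profile vs y)) →
  Σ (Permutation n n) λ π → permute π x ≡ y × (∀ r → permute π (lookup vs r) ≡ lookup vs r)
equal-profile-counts⇒permute vs {x} {y} same
  with π , profile∘π≗profile ← equal-counts⇒permutation _≟_ (profile vs x) (profile vs y) same =
  π , permute-≗ π x y (same-columns zero) ,
  λ r → permute-≗ π (lookup vs r) (lookup vs r) (same-columns (suc r))
  where
  same-columns : ∀ r i → column (x ∷ vs) (π ⟨$⟩ʳ i) r ≡ column (y ∷ vs) i r
  same-columns r i =
    encode-injective {f = column (x ∷ vs) (π ⟨$⟩ʳ i)} {column (y ∷ vs) i} (profile∘π≗profile i) r

signature : ∀ {ℓ n} → Vec (PI n) ℓ → PI n → Fin (suc n ^ 3 ^ suc ℓ)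
signature vs x = funToFin λ k → fromℕ< (s≤s (count≤ _≟_ k (profile vs x)))

signature-counts : ∀ {ℓ n} (vs : Vec (PI n) ℓ) x y → signature vs x ≡ signature vs y →
  ∀ k → count _≟_ k (profile vs x) ≡ count _≟_ k (profile vs y)
signature-counts vs x y same k = fromℕ<-injective _ _ _ _ (funToFin-injective same k)

Chain⇒Linked : ∀ {ℓ n} (ρ : Form (2 + ℓ)) (T : DT n) vs es → Chain ρ T vs es → Linked (Holds ρ T vs) es
Chain⇒Linked ρ T vs [] _ = []
Chain⇒Linked ρ T vs (_ ∷ []) _ = [-]
Chain⇒Linked ρ T vs (_ ∷ es@(_ ∷ _)) (Rxy , chain) = Rxy ∷ Chain⇒Linked ρ T vs es chain

module _ {ℓ} (ρ : Form (2 + ℓ)) (spo : StrictPartialOrder ρ) {n} (T : DT n) (vs : Vec (PI n) ℓ) where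

  private
    R = Holds ρ T vs
    irrefl = proj₁ (spo n T vs)

    trans-R : Transitive R
    trans-R = proj₂ (spo n T vs) _ _ _

  related⇒signature-≢ : ∀ {x y} → R x y → signature vs x ≢ signature vs y
  related⇒signature-≢ {x} {y} Rxy same
    with π , πx≡y , fixes ← equal-profile-counts⇒permute vs {x} {y} (signature-counts vs x y same) =
    preserving⇒¬ascent {R = R} (encode ∘ lookup) (lookup-≗⇒≡ ∘ encode-injective) irrefl trans-R
      (Holds-permute ρ T {vs} π fixes) (subst (R x) (sym πx≡y) Rxy)

  Chain-length≤ : ∀ es → Chain ρ T vs es → length es ≤ suc n ^ 3 ^ suc ℓ
  Chain-length≤ es chain =
    AllPairs⇒length≤ (signature vs) related⇒signature-≢
      (Linked⇒AllPairs trans-R (Chain⇒Linked ρ T vs es chain))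

_⊕_ : List ℕ → List ℕ → List ℕ
[] ⊕ q = q
(a ∷ p) ⊕ [] = a ∷ p
(a ∷ p) ⊕ (b ∷ q) = (a + b) ∷ (p ⊕ q)

evalPoly-⊕ : ∀ p q x → evalPoly (p ⊕ q) x ≡ evalPoly p x + evalPoly q x
evalPoly-⊕ [] q x = refl
evalPoly-⊕ (a ∷ p) [] x = sym (+-identityʳ _)
evalPoly-⊕ (a ∷ p) (b ∷ q) x =
  trans (cong (λ t → a + b + x * t) (evalPoly-⊕ p q x)) (regroup a b x (evalPoly p x) (evalPoly q x))
  where
  regroup : ∀ a b x P Q → a + b + x * (P + Q) ≡ a + x * P + (b + x * Q)
  regroup = solve-∀

sucPow : ℕ → List ℕ
sucPow zero = 1 ∷ []
sucPow (suc d) = sucPow d ⊕ (0 ∷ sucPow d)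

evalPoly-sucPow : ∀ d x → evalPoly (sucPow d) x ≡ suc x ^ d
evalPoly-sucPow zero x = cong suc (*-zeroʳ x)
evalPoly-sucPow (suc d) x =
  trans (evalPoly-⊕ (sucPow d) (0 ∷ sucPow d) x) (cong (λ t → t + x * t) (evalPoly-sucPow d x))

lemma22 : ∀ {ℓ : ℕ} (ρ : Form (2 + ℓ)) → StrictPartialOrder ρ →
    Σ (List ℕ) λ p → ∀ (n : ℕ) (es : List (PI n)) → IsPath ρ n es → length es ≤ evalPoly p n
lemma22 {ℓ} ρ spo = sucPow (3 ^ suc ℓ) , λ { n es (T , vs , chain) →
  subst (length es ≤_) (sym (evalPoly-sucPow (3 ^ suc ℓ) n)) (Chain-length≤ ρ spo T vs es chain) }
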